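{- Let $G$ be a prime bull-free graph. Then $G$ contains neither $G_1$ nor $G_2$ as an induced subgraph.
   Context: Graphs are finite and simple. The bull is the graph with vertices $a,b,c,d,e$ and edges $ab, bc, cd, be, ce$; bull-free means having no induced subgraph isomorphic to the bull. A homogeneous set in $G$ is a set $S\subseteq V(G)$ such that every vertex of $V(G)\setminus S$ is either adjacent to all vertices of $S$ or to none of them; it is proper if $|S|\ge 2$ and $S\neq V(G)$. $G$ is prime if it has no proper homogeneous set. $G_1$ is the graph with vertices $p_1,\dots,p_5,d,a$ whose edges are $p_1p_2,p_2p_3,p_3p_4,p_4p_5,p_5p_1$ (a $5$-cycle), $dp_5$, and $ap_5, ap_1, ap_2$, with no other edges. $G_2$ is the graph with vertices $p_1,\dots,p_5,d,a$ whose edges are $p_1p_2,p_2p_3,p_3p_4,p_4p_5,p_5p_1$, $dp_5$, and $ap_1,ap_2,ap_3$, with no other edges. -}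

module Defs where

open import Data.Nat using (ℕ; _≥_)
open import Data.Fin using (Fin; zero; suc)
open import Data.Fin.Subset using (Subset; _∈_; _∉_; ∣_∣)
open import Data.Product using (Σ; _×_; ∃)
open import Data.Sum using (_⊎_)
open import Relation.Nullary using (¬_; Dec; yes; no)
open import Data.Bool using (Bool; true; false; T; _∨_)
open import Data.Bool.Properties using (∨-comm; T?)
open import Data.Unit using (tt)
open import Relation.Binary.PropositionalEquality using (_≡_; refl; subst; cong)
open import Function.Definitions using (Injective)
open import Level using (0ℓ)

record Graph : Set₁ where
  field
    n     : ℕ
    Adj   : Fin n → Fin n → Set
    sym   : ∀ {x y} → Adj x y → Adj y x
    irrefl : ∀ {x} → ¬ Adj x x
    dec   : ∀ x y → Dec (Adj x y)
open Graph public

V : Graph → Set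
V G = Fin (n G)

record InducedSub (H G : Graph) : Set where
  field
    f     : V H → V G
    inj   : Injective _≡_ _≡_ f
    pres  : ∀ x y → Adj H x y → Adj G (f x) (f y)
    refl' : ∀ x y → Adj G (f x) (f y) → Adj H x y

Homogeneous : (G : Graph) → Subset (n G) → Set
Homogeneous G S =
  ∀ v → v ∉ S → (∀ s → s ∈ S → Adj G v s) ⊎ (∀ s → s ∈ S → ¬ Adj G v s)

ProperHomogeneous : (G : Graph) → Subset (n G) → Set
ProperHomogeneous G S = Homogeneous G S × (∣ S ∣ ≥ 2) × ∃ (λ v → v ∉ S)

Prime : Graph → Set
Prime G = ∀ S → ¬ ProperHomogeneous G S

fromEdges : (k : ℕ) (e : Fin k → Fin k → Bool) →
  (∀ x → e x x ≡ false) → Graph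
fromEdges k e irr = record
  { n = k
  ; Adj = λ x y → T (e x y ∨ e y x)
  ; sym = λ {x} {y} p → subst T (∨-comm (e x y) (e y x)) p
  ; irrefl = λ {x} p → subst T (cong (λ b → b ∨ b) (irr x)) p
  ; dec = λ x y → T? (e x y ∨ e y x)
  }

-- Bull: vertices a b c d e = 0..4, edges ab bc cd be ce.
bullE : Fin 5 → Fin 5 → Bool
bullE zero (suc zero) = true
bullE (suc zero) (suc (suc zero)) = true
bullE (suc (suc zero)) (suc (suc (suc zero))) = true
bullE (suc zero) (suc (suc (suc (suc zero)))) = true
bullE (suc (suc zero)) (suc (suc (suc (suc zero)))) = true
bullE _ _ = false

Bull : Graph
Bull = fromEdges 5 bullE λ { zero → refl ; (suc zero) → refl ; (suc (suc zero)) → refl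
  ; (suc (suc (suc zero))) → refl ; (suc (suc (suc (suc zero)))) → refl }

BullFree : Graph → Set
BullFree G = ¬ InducedSub Bull G

-- Vertices of G₁, G₂ (Fin 7): p1..p5 = 0..4, d = 5, a = 6.
-- G₁ edges: 5-cycle p1p2 p2p3 p3p4 p4p5 p5p1, d p5, a p5, a p1, a p2.
g1E : Fin 7 → Fin 7 → Bool
g1E zero (suc zero) = true
g1E (suc zero) (suc (suc zero)) = true
g1E (suc (suc zero)) (suc (suc (suc zero))) = true
g1E (suc (suc (suc zero))) (suc (suc (suc (suc zero)))) = true
g1E (suc (suc (suc (suc zero)))) zero = true
g1E (suc (suc (suc (suc (suc zero))))) (suc (suc (suc (suc zero)))) = true
g1E (suc (suc (suc (suc (suc (suc zero)))))) (suc (suc (suc (suc zero)))) = true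
g1E (suc (suc (suc (suc (suc (suc zero)))))) zero = true
g1E (suc (suc (suc (suc (suc (suc zero)))))) (suc zero) = true
g1E _ _ = false

-- G₂ edges: 5-cycle, d p5, a p1, a p2, a p3.
g2E : Fin 7 → Fin 7 → Bool
g2E zero (suc zero) = true
g2E (suc zero) (suc (suc zero)) = true
g2E (suc (suc zero)) (suc (suc (suc zero))) = true
g2E (suc (suc (suc zero))) (suc (suc (suc (suc zero)))) = true
g2E (suc (suc (suc (suc zero)))) zero = true
g2E (suc (suc (suc (suc (suc zero))))) (suc (suc (suc (suc zero)))) = true
g2E (suc (suc (suc (suc (suc (suc zero)))))) zero = true
g2E (suc (suc (suc (suc (suc (suc zero)))))) (suc zero) = true
g2E (suc (suc (suc (suc (suc (suc zero)))))) (suc (suc zero)) = true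
g2E _ _ = false

irr7 : (e : Fin 7 → Fin 7 → Bool) → Set
irr7 e = ∀ x → e x x ≡ false

g1-irr : irr7 g1E
g1-irr zero = refl
g1-irr (suc zero) = refl
g1-irr (suc (suc zero)) = refl
g1-irr (suc (suc (suc zero))) = refl
g1-irr (suc (suc (suc (suc zero)))) = refl
g1-irr (suc (suc (suc (suc (suc zero))))) = refl
g1-irr (suc (suc (suc (suc (suc (suc zero)))))) = refl

g2-irr : irr7 g2E
g2-irr zero = refl
g2-irr (suc zero) = refl
g2-irr (suc (suc zero)) = refl
g2-irr (suc (suc (suc zero))) = refl
g2-irr (suc (suc (suc (suc zero)))) = refl
g2-irr (suc (suc (suc (suc (suc zero))))) = refl
g2-irr (suc (suc (suc (suc (suc (suc zero)))))) = refl

G₁ : Graph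
G₁ = fromEdges 7 g1E g1-irr

G₂ : Graph
G₂ = fromEdges 7 g2E g2-irr

-- In G₁ the vertices p₁ and a are adjacent and have the same neighbours on the frame
-- p₂p₃p₄p₅d; in G₂ the same holds for p₂ and a on p₁p₃p₄p₅d.  In a host graph G, consider
-- the vertices whose trace on the frame is that common trace, and let S be the component of
-- this class containing the edge p₁a (resp. p₂a).  A vertex of the class with a neighbour in
-- S lies in S; a vertex outside the class that is mixed on S splits an edge of S (S is
-- connected), and a finite check over the 31 other traces shows that this always produces a
-- bull.  So S is a homogeneous set with at least two vertices that misses p₂ (resp. p₁).
module Submission where

open import Defs
open import Data.Product using (_×_)
open import Relation.Nullary using (¬_)

open import Data.Bool as Bool using (Bool; true; false)
open import Data.Empty using (⊥; ⊥-elim)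
open import Data.Fin as Fin using (Fin; zero; #_)
open import Data.Fin.Properties using (all?; any?; ¬∀⟶∃¬)
open import Data.Fin.Subset using (Subset; _∈_; _∉_; ∣_∣; _∪_; ⁅_⁆)
open import Data.Fin.Subset.Properties
  using (_∈?_; ∣p∣≤n; p⊂q⇒∣p∣<∣q∣; x∈⁅x⁆; x∈⁅y⁆⇒x≡y; x∈p∪q⁻; x∈p∪q⁺; ∣⁅x⁆∣≡1)
open import Data.Nat using (ℕ; zero; suc; _+_; _≤_; _<_)
open import Data.Nat.Properties
  using (≤-trans; <-≤-trans; <-irrefl; <⇒≤; +-suc; +-monoʳ-≤; ≤-reflexive; m≤m+n)
open import Data.Product using (∃; ∃₂; _,_)
open import Data.Sum using (_⊎_; inj₁; inj₂; [_,_]′; map₂)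
open import Data.Vec using (Vec; []; _∷_; lookup; tabulate)
open import Data.Vec.Properties using (lookup∘tabulate; tabulate-cong; ≡-dec)
open import Function using (id; _∘_)
open import Relation.Nullary using (Dec; yes; no; does; ¬?)
open import Relation.Nullary.Decidable using (True; toWitness; dec-true; dec-false; _⊎-dec_; _→-dec_)
open import Relation.Binary.PropositionalEquality
  using (_≡_; _≢_; refl; trans; cong; subst; module ≡-Reasoning)
  renaming (sym to ≡-sym)

adj? : (G : Graph) → V G → V G → Bool
adj? G x y = does (dec G x y)

module _ (G : Graph) where

  adj?-true : ∀ {x y} → Adj G x y → adj? G x y ≡ true
  adj?-true {x} {y} = dec-true (dec G x y)

  adj?-false : ∀ {x y} → ¬ Adj G x y → adj? G x y ≡ false
  adj?-false {x} {y} = dec-false (dec G x y)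

  adj?-irrefl : ∀ x → adj? G x x ≡ false
  adj?-irrefl x = adj?-false (irrefl G)

  adj?-sound : ∀ {x y} → adj? G x y ≡ true → Adj G x y
  adj?-sound {x} {y} with dec G x y
  ... | yes xy = λ _ → xy
  ... | no _   = λ ()

  adj?-sym : ∀ x y → adj? G x y ≡ adj? G y x
  adj?-sym x y with dec G y x
  ... | yes yx = adj?-true (sym G yx)
  ... | no ¬yx = adj?-false (¬yx ∘ sym G)

adj?-embed : ∀ {H G} (e : InducedSub H G) x y →
  adj? G (InducedSub.f e x) (InducedSub.f e y) ≡ adj? H x y
adj?-embed {H} {G} e x y with dec H x y
... | yes xy = adj?-true G (InducedSub.pres e x y xy)
... | no ¬xy = adj?-false G (¬xy ∘ InducedSub.refl' e x y)

TwinFree : Graph → Set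
TwinFree H = ∀ x y → (∀ z → adj? H x z ≡ adj? H y z) → x ≡ y

twinFree-embedding : ∀ {H G} → TwinFree H → (f : V H → V G) →
  (∀ x y → adj? G (f x) (f y) ≡ adj? H x y) → InducedSub H G
twinFree-embedding {H} {G} twinFree f f-adj = record
  { f     = f
  ; inj   = λ {x} {y} fx≡fy → twinFree x y λ z → begin
      adj? H x z         ≡⟨ ≡-sym (f-adj x z) ⟩
      adj? G (f x) (f z) ≡⟨ cong (λ w → adj? G w (f z)) fx≡fy ⟩
      adj? G (f y) (f z) ≡⟨ f-adj y z ⟩
      adj? H y z         ∎
  ; pres  = λ x y xy → adj?-sound G (trans (f-adj x y) (adj?-true H xy))
  ; refl' = λ x y fxfy → adj?-sound H (trans (≡-sym (f-adj x y)) (adj?-true G fxfy))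
  }
  where open ≡-Reasoning

Bull-distinguishing : ∀ x y → x ≡ y ⊎ ∃ λ z → adj? Bull x z ≢ adj? Bull y z
Bull-distinguishing = toWitness {a? = all? λ x → all? λ y →
  x Fin.≟ y ⊎-dec any? λ z → ¬? (adj? Bull x z Bool.≟ adj? Bull y z)} _

Bull-twinFree : TwinFree Bull
Bull-twinFree x y same =
  [ id , (λ { (z , differs) → ⊥-elim (differs (same z)) }) ]′ (Bull-distinguishing x y)

module _ {m : ℕ} {S : Subset m} {w : Fin m} where

  ∈-insert⁻ : ∀ {x} → x ∈ S ∪ ⁅ w ⁆ → x ∈ S ⊎ x ≡ w
  ∈-insert⁻ x∈ = map₂ (x∈⁅y⁆⇒x≡y w) (x∈p∪q⁻ S ⁅ w ⁆ x∈)

  ∈-insert-there : ∀ {x} → x ∈ S → x ∈ S ∪ ⁅ w ⁆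
  ∈-insert-there x∈S = x∈p∪q⁺ (inj₁ x∈S)

  ∈-insert-here : w ∈ S ∪ ⁅ w ⁆
  ∈-insert-here = x∈p∪q⁺ {p = S} (inj₂ (x∈⁅x⁆ w))

  ∣insert∣ : w ∉ S → ∣ S ∣ < ∣ S ∪ ⁅ w ⁆ ∣
  ∣insert∣ w∉S = p⊂q⇒∣p∣<∣q∣ (∈-insert-there , w , ∈-insert-here , w∉S)

module _ (G : Graph) where

  Mixed : V G → Subset (n G) → Set
  Mixed v S = ∃₂ λ y z → y ∈ S × z ∈ S × Adj G v y × ¬ Adj G v z

  SplitsEdge : V G → Subset (n G) → Set
  SplitsEdge v S = ∃₂ λ y z → y ∈ S × z ∈ S × Adj G y z × Adj G v y × ¬ Adj G v z

  ∃-non-neighbour : ∀ {S v} → ¬ (∀ s → s ∈ S → Adj G v s) → ∃ λ z → z ∈ S × ¬ Adj G v z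
  ∃-non-neighbour {S} {v} incomplete
    with ¬∀⟶∃¬ (n G) _ (λ s → s ∈? S →-dec dec G v s) incomplete
  ... | z , ¬[z∈S⇒vz] with z ∈? S
  ...   | yes z∈S = z , z∈S , λ vz → ¬[z∈S⇒vz] (λ _ → vz)
  ...   | no  z∉S = ⊥-elim (¬[z∈S⇒vz] (⊥-elim ∘ z∉S))

  unmixed⇒complete⊎anticomplete : ∀ {S v} → ¬ Mixed v S →
    (∀ s → s ∈ S → Adj G v s) ⊎ (∀ s → s ∈ S → ¬ Adj G v s)
  unmixed⇒complete⊎anticomplete {S} {v} unmixed
    with all? (λ s → s ∈? S →-dec dec G v s)
  ... | yes complete   = inj₁ complete
  ... | no  incomplete = inj₂ λ y y∈S vy →
    let z , z∈S , ¬vz = ∃-non-neighbour incomplete in unmixed (y , z , y∈S , z∈S , vy , ¬vz)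

  NoSplit : (V G → Set) → Set
  NoSplit C = ∀ {v y z} → ¬ C v → C y → C z → Adj G y z → Adj G v y → ¬ Adj G v z → ⊥

module _ (G : Graph) (C : V G → Set) where

  -- Splitting of edges by mixed vertices replaces connectivity of S: it is all the
  -- argument needs, and it is preserved by adding a vertex with a neighbour in S.
  record Cluster (S : Subset (n G)) : Set where
    field
      ⊆C               : ∀ {s} → s ∈ S → C s
      mixed⇒splitsEdge : ∀ {v} → Mixed G v S → SplitsEdge G v S

  Closed : Subset (n G) → Set
  Closed S = ∀ {w s} → C w → w ∉ S → s ∈ S → ¬ Adj G w s

  singleton-cluster : ∀ {x} → C x → Cluster ⁅ x ⁆
  singleton-cluster {x} Cx = record
    { ⊆C               = λ s∈ → subst C (≡-sym (x∈⁅y⁆⇒x≡y x s∈)) Cx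
    ; mixed⇒splitsEdge = λ { {v} (y , z , y∈ , z∈ , vy , ¬vz) →
        ⊥-elim (¬vz (subst (Adj G v) (trans (x∈⁅y⁆⇒x≡y x y∈) (≡-sym (x∈⁅y⁆⇒x≡y x z∈))) vy)) }
    }

  cluster-insert : ∀ {S w s} → Cluster S → C w → s ∈ S → Adj G w s → Cluster (S ∪ ⁅ w ⁆)
  cluster-insert {S} {w} {s} cluster Cw s∈S ws = record { ⊆C = ⊆C′ ; mixed⇒splitsEdge = splits }
    where
    open Cluster cluster

    ⊆C′ : ∀ {x} → x ∈ S ∪ ⁅ w ⁆ → C x
    ⊆C′ x∈ with ∈-insert⁻ x∈
    ... | inj₁ x∈S = ⊆C x∈S
    ... | inj₂ refl = Cw

    lift : ∀ {v} → SplitsEdge G v S → SplitsEdge G v (S ∪ ⁅ w ⁆)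
    lift (y , z , y∈ , z∈ , yz , vy , ¬vz) =
      y , z , ∈-insert-there y∈ , ∈-insert-there z∈ , yz , vy , ¬vz

    -- A vertex mixed on S ∪ {w} but not on S splits the edge ws.
    splits : ∀ {v} → Mixed G v (S ∪ ⁅ w ⁆) → SplitsEdge G v (S ∪ ⁅ w ⁆)
    splits {v} (y , z , y∈ , z∈ , vy , ¬vz) with ∈-insert⁻ y∈ | ∈-insert⁻ z∈ | dec G v s
    ... | inj₁ y∈S | inj₁ z∈S | _      = lift (mixed⇒splitsEdge (y , z , y∈S , z∈S , vy , ¬vz))
    ... | inj₂ refl | inj₂ refl | _     = ⊥-elim (¬vz vy)
    ... | inj₂ refl | inj₁ z∈S | yes vs = lift (mixed⇒splitsEdge (s , z , s∈S , z∈S , vs , ¬vz))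
    ... | inj₂ refl | inj₁ z∈S | no ¬vs =
      w , s , ∈-insert-here , ∈-insert-there s∈S , ws , vy , ¬vs
    ... | inj₁ y∈S | inj₂ refl | yes vs =
      s , w , ∈-insert-there s∈S , ∈-insert-here , sym G ws , vs , ¬vz
    ... | inj₁ y∈S | inj₂ refl | no ¬vs = lift (mixed⇒splitsEdge (y , s , y∈S , s∈S , vy , ¬vs))

  module _ (C? : ∀ v → Dec (C v)) (noSplit : NoSplit G C) where

    closed-cluster-homogeneous : ∀ {S} → Cluster S → Closed S → Homogeneous G S
    closed-cluster-homogeneous {S} cluster closed v v∉S = unmixed⇒complete⊎anticomplete G unmixed
      where
      open Cluster cluster
      unmixed : ¬ Mixed G v S
      unmixed mixed with mixed⇒splitsEdge mixed | C? v
      ... | y , z , y∈ , z∈ , yz , vy , ¬vz | yes Cv  = closed Cv v∉S y∈ vy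
      ... | y , z , y∈ , z∈ , yz , vy , ¬vz | no  ¬Cv = noSplit ¬Cv (⊆C y∈) (⊆C z∈) yz vy ¬vz

    unsplit-class⇒¬Prime : ∀ {x₀ x₁ u} → C x₀ → C x₁ → Adj G x₀ x₁ → ¬ C u → ¬ Prime G
    unsplit-class⇒¬Prime {x₀} {x₁} {u} Cx₀ Cx₁ x₀x₁ ¬Cu prime =
      no-cluster (n G) (m≤m+n (n G) _) pair-big pair-cluster
      where
      no-cluster : ∀ k {S} → n G ≤ k + ∣ S ∣ → 2 ≤ ∣ S ∣ → Cluster S → ⊥
      closed : ∀ k {S} → n G ≤ k + ∣ S ∣ → 2 ≤ ∣ S ∣ → Cluster S → Closed S

      no-cluster k bound big cluster = prime _
        ( closed-cluster-homogeneous cluster (closed k bound big cluster)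
        , big , u , ¬Cu ∘ Cluster.⊆C cluster )

      -- Otherwise w joins the cluster, which cannot grow beyond n G vertices.
      closed zero {S} bound big cluster {w} Cw w∉S s∈S ws =
        <-irrefl refl (<-≤-trans (∣insert∣ w∉S) (≤-trans (∣p∣≤n (S ∪ ⁅ w ⁆)) bound))
      closed (suc k) {S} bound big cluster {w} Cw w∉S s∈S ws =
        no-cluster k bound′ (≤-trans big (<⇒≤ (∣insert∣ w∉S))) (cluster-insert cluster Cw s∈S ws)
        where
        bound′ : n G ≤ k + ∣ S ∪ ⁅ w ⁆ ∣
        bound′ = ≤-trans bound (≤-trans (≤-reflexive (≡-sym (+-suc k ∣ S ∣)))
                                        (+-monoʳ-≤ k (∣insert∣ w∉S)))

      pair-cluster : Cluster (⁅ x₀ ⁆ ∪ ⁅ x₁ ⁆)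
      pair-cluster = cluster-insert (singleton-cluster Cx₀) Cx₁ (x∈⁅x⁆ x₀) (sym G x₀x₁)

      pair-big : 2 ≤ ∣ ⁅ x₀ ⁆ ∪ ⁅ x₁ ⁆ ∣
      pair-big = subst (_< ∣ ⁅ x₀ ⁆ ∪ ⁅ x₁ ⁆ ∣) (∣⁅x⁆∣≡1 x₀) (∣insert∣ x₁∉⁅x₀⁆)
        where
        x₁∉⁅x₀⁆ : x₁ ∉ ⁅ x₀ ⁆
        x₁∉⁅x₀⁆ x₁∈ = irrefl G (subst (Adj G x₀) (x∈⁅y⁆⇒x≡y x₀ x₁∈) x₀x₁)

trace : (G : Graph) {k : ℕ} → (Fin k → V G) → V G → Vec Bool k
trace G q v = tabulate (λ i → adj? G v (q i))

lookup-trace : ∀ (G : Graph) {k} (q : Fin k → V G) v i → lookup (trace G q v) i ≡ adj? G v (q i)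
lookup-trace G q v = lookup∘tabulate (λ i → adj? G v (q i))

-- The vertices in play when a vertex `splitter` outside the class of a trace pattern sees
-- `seen` but not `unseen`, where seen–unseen is an edge inside the class: all adjacencies
-- are fixed by the frame, the pattern and the splitter's own trace bs.
data Node (k : ℕ) : Set where
  frame : Fin k → Node k
  seen unseen splitter : Node k

configuration : ∀ {k} → (Fin k → Fin k → Bool) → (pat bs : Vec Bool k) → Node k → Node k → Bool
configuration F pat bs (frame i) (frame j) = F i j
configuration F pat bs (frame i) splitter  = lookup bs i
configuration F pat bs splitter  (frame i) = lookup bs i
configuration F pat bs (frame i) _         = lookup pat i
configuration F pat bs _         (frame i) = lookup pat i
configuration F pat bs seen      unseen    = true
configuration F pat bs unseen    seen      = true
configuration F pat bs seen      splitter  = true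
configuration F pat bs splitter  seen      = true
configuration F pat bs _         _         = false

record InducesBull {k} (m : Node k → Node k → Bool) (t : Fin 5 → Node k) : Set where
  constructor induces
  field adjacency : ∀ i j → m (t i) (t j) ≡ adj? Bull i j

bull-at : ∀ {k} {m : Node k → Node k → Bool} (ts : Vec (Node k) 5) →
  {True (all? λ i → all? λ j → m (lookup ts i) (lookup ts j) Bool.≟ adj? Bull i j)} →
  ∃ (InducesBull m)
bull-at ts {ok} = lookup ts , induces (toWitness ok)

BullCertificate : ∀ {k} → (Fin k → Fin k → Bool) → Vec Bool k → Set
BullCertificate F pat = ∀ bs → bs ≢ pat → ∃ (InducesBull (configuration F pat bs))

certified-noSplit : ∀ {G : Graph} → BullFree G → ∀ {k} (q : Fin k → V G) {F pat} →
  (∀ i j → adj? G (q i) (q j) ≡ F i j) → BullCertificate F pat →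
  NoSplit G (λ v → trace G q v ≡ pat)
certified-noSplit {G} bullFree {k} q {F} {pat} q-adj certificate {v} {y} {z} ¬Cv Cy Cz yz vy ¬vz =
  let t , t-bull = certificate (trace G q v) ¬Cv in
  bullFree (twinFree-embedding Bull-twinFree (realise ∘ t)
    λ i j → trans (realise-adj (t i) (t j)) (InducesBull.adjacency t-bull i j))
  where
  realise : Node k → V G
  realise (frame i) = q i
  realise seen      = y
  realise unseen    = z
  realise splitter  = v

  on-pattern : ∀ {x} → trace G q x ≡ pat → ∀ i → adj? G x (q i) ≡ lookup pat i
  on-pattern {x} Cx i = trans (≡-sym (lookup-trace G q x i)) (cong (λ p → lookup p i) Cx)

  realise-adj : ∀ a b → adj? G (realise a) (realise b) ≡ configuration F pat (trace G q v) a b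
  realise-adj (frame i) (frame j) = q-adj i j
  realise-adj (frame i) seen      = trans (adj?-sym G (q i) y) (on-pattern Cy i)
  realise-adj (frame i) unseen    = trans (adj?-sym G (q i) z) (on-pattern Cz i)
  realise-adj (frame i) splitter  = trans (adj?-sym G (q i) v) (≡-sym (lookup-trace G q v i))
  realise-adj seen      (frame i) = on-pattern Cy i
  realise-adj unseen    (frame i) = on-pattern Cz i
  realise-adj splitter  (frame i) = ≡-sym (lookup-trace G q v i)
  realise-adj seen      seen      = adj?-irrefl G y
  realise-adj seen      unseen    = adj?-true G yz
  realise-adj seen      splitter  = adj?-true G (sym G vy)
  realise-adj unseen    seen      = adj?-true G (sym G yz)
  realise-adj unseen    unseen    = adj?-irrefl G z
  realise-adj unseen    splitter  = adj?-false G (¬vz ∘ sym G)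
  realise-adj splitter  seen      = adj?-true G vy
  realise-adj splitter  unseen    = adj?-false G ¬vz
  realise-adj splitter  splitter  = adj?-irrefl G v

certified-twins⇒¬InducedSub : ∀ {G H : Graph} {k} (q : Fin k → V H) (x₀ x₁ : V H) →
  Adj H x₀ x₁ → trace H q x₀ ≡ trace H q x₁ → (∃ λ i → Adj H x₀ (q i)) →
  BullCertificate (λ i j → adj? H (q i) (q j)) (trace H q x₀) →
  Prime G → BullFree G → ¬ InducedSub H G
certified-twins⇒¬InducedSub {G} {H} {k} q x₀ x₁ x₀x₁ twins (i , x₀qᵢ) certificate prime bullFree e =
  unsplit-class⇒¬Prime G C C? noSplit
    (C-image refl) (C-image (≡-sym twins)) (InducedSub.pres e x₀ x₁ x₀x₁) ¬C-fqᵢ prime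
  where
  open ≡-Reasoning
  f : V H → V G
  f = InducedSub.f e

  pat : Vec Bool k
  pat = trace H q x₀

  C : V G → Set
  C v = trace G (f ∘ q) v ≡ pat

  C? : ∀ v → Dec (C v)
  C? v = ≡-dec Bool._≟_ (trace G (f ∘ q) v) pat

  noSplit : NoSplit G C
  noSplit = certified-noSplit bullFree (f ∘ q) (λ i j → adj?-embed e (q i) (q j)) certificate

  C-image : ∀ {x} → trace H q x ≡ pat → C (f x)
  C-image {x} Cx = trans (tabulate-cong (λ i → adj?-embed e x (q i))) Cx

  ¬C-fqᵢ : ¬ C (f (q i))
  ¬C-fqᵢ C-fqᵢ with (begin
    false                                ≡⟨ ≡-sym (adj?-irrefl G (f (q i))) ⟩
    adj? G (f (q i)) (f (q i))           ≡⟨ ≡-sym (lookup-trace G (f ∘ q) (f (q i)) i) ⟩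
    lookup (trace G (f ∘ q) (f (q i))) i ≡⟨ cong (λ p → lookup p i) C-fqᵢ ⟩
    lookup pat i                         ≡⟨ lookup-trace H q x₀ i ⟩
    adj? H x₀ (q i)                      ≡⟨ adj?-true H x₀qᵢ ⟩
    true                                 ∎)
  ... | ()

-- p₂ p₃ p₄ p₅ d, on which p₁ and a are adjacent twins.
G₁-frame : Fin 5 → V G₁
G₁-frame = lookup (# 1 ∷ # 2 ∷ # 3 ∷ # 4 ∷ # 5 ∷ [])

G₁-certificate : BullCertificate (λ i j → adj? G₁ (G₁-frame i) (G₁-frame j)) (trace G₁ G₁-frame (# 0))
G₁-certificate (false ∷ false ∷ false ∷ false ∷ false ∷ []) _
  = bull-at (frame (# 1) ∷ frame (# 0) ∷ seen ∷ splitter ∷ unseen ∷ [])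
G₁-certificate (false ∷ false ∷ false ∷ false ∷ true  ∷ []) _
  = bull-at (frame (# 1) ∷ frame (# 0) ∷ seen ∷ splitter ∷ unseen ∷ [])
G₁-certificate (false ∷ false ∷ false ∷ true  ∷ false ∷ []) _
  = bull-at (frame (# 0) ∷ seen ∷ frame (# 3) ∷ frame (# 2) ∷ splitter ∷ [])
G₁-certificate (false ∷ false ∷ false ∷ true  ∷ true  ∷ []) _
  = bull-at (frame (# 0) ∷ seen ∷ frame (# 3) ∷ frame (# 2) ∷ splitter ∷ [])
G₁-certificate (false ∷ false ∷ true  ∷ false ∷ false ∷ []) _
  = bull-at (frame (# 1) ∷ frame (# 0) ∷ seen ∷ splitter ∷ unseen ∷ [])
G₁-certificate (false ∷ false ∷ true  ∷ false ∷ true  ∷ []) _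
  = bull-at (frame (# 1) ∷ frame (# 0) ∷ seen ∷ splitter ∷ unseen ∷ [])
G₁-certificate (false ∷ false ∷ true  ∷ true  ∷ false ∷ []) _
  = bull-at (frame (# 0) ∷ seen ∷ frame (# 3) ∷ frame (# 4) ∷ splitter ∷ [])
G₁-certificate (false ∷ false ∷ true  ∷ true  ∷ true  ∷ []) _
  = bull-at (frame (# 1) ∷ frame (# 0) ∷ seen ∷ splitter ∷ unseen ∷ [])
G₁-certificate (false ∷ true  ∷ false ∷ false ∷ false ∷ []) _
  = bull-at (frame (# 2) ∷ frame (# 3) ∷ seen ∷ splitter ∷ unseen ∷ [])
G₁-certificate (false ∷ true  ∷ false ∷ false ∷ true  ∷ []) _
  = bull-at (frame (# 2) ∷ frame (# 3) ∷ seen ∷ splitter ∷ unseen ∷ [])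
G₁-certificate (false ∷ true  ∷ false ∷ true  ∷ false ∷ []) _
  = bull-at (frame (# 0) ∷ seen ∷ frame (# 3) ∷ frame (# 2) ∷ splitter ∷ [])
G₁-certificate (false ∷ true  ∷ false ∷ true  ∷ true  ∷ []) _
  = bull-at (frame (# 0) ∷ seen ∷ frame (# 3) ∷ frame (# 2) ∷ splitter ∷ [])
G₁-certificate (false ∷ true  ∷ true  ∷ false ∷ false ∷ []) _
  = bull-at (frame (# 0) ∷ frame (# 1) ∷ frame (# 2) ∷ frame (# 3) ∷ splitter ∷ [])
G₁-certificate (false ∷ true  ∷ true  ∷ false ∷ true  ∷ []) _
  = bull-at (frame (# 0) ∷ frame (# 1) ∷ frame (# 2) ∷ frame (# 3) ∷ splitter ∷ [])
G₁-certificate (false ∷ true  ∷ true  ∷ true  ∷ false ∷ []) _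
  = bull-at (frame (# 0) ∷ seen ∷ frame (# 3) ∷ frame (# 4) ∷ splitter ∷ [])
G₁-certificate (false ∷ true  ∷ true  ∷ true  ∷ true  ∷ []) _
  = bull-at (frame (# 0) ∷ frame (# 1) ∷ splitter ∷ frame (# 4) ∷ frame (# 2) ∷ [])
G₁-certificate (true  ∷ false ∷ false ∷ false ∷ false ∷ []) _
  = bull-at (frame (# 1) ∷ frame (# 0) ∷ seen ∷ frame (# 3) ∷ splitter ∷ [])
G₁-certificate (true  ∷ false ∷ false ∷ false ∷ true  ∷ []) _
  = bull-at (frame (# 1) ∷ frame (# 0) ∷ seen ∷ frame (# 3) ∷ splitter ∷ [])
G₁-certificate (true  ∷ false ∷ false ∷ true  ∷ false ∷ []) ≢pat
  = ⊥-elim (≢pat refl)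
G₁-certificate (true  ∷ false ∷ false ∷ true  ∷ true  ∷ []) _
  = bull-at (frame (# 0) ∷ splitter ∷ frame (# 3) ∷ frame (# 2) ∷ frame (# 4) ∷ [])
G₁-certificate (true  ∷ false ∷ true  ∷ false ∷ false ∷ []) _
  = bull-at (frame (# 1) ∷ frame (# 0) ∷ seen ∷ frame (# 3) ∷ splitter ∷ [])
G₁-certificate (true  ∷ false ∷ true  ∷ false ∷ true  ∷ []) _
  = bull-at (frame (# 1) ∷ frame (# 0) ∷ seen ∷ frame (# 3) ∷ splitter ∷ [])
G₁-certificate (true  ∷ false ∷ true  ∷ true  ∷ false ∷ []) _
  = bull-at (frame (# 0) ∷ splitter ∷ frame (# 3) ∷ frame (# 4) ∷ frame (# 2) ∷ [])
G₁-certificate (true  ∷ false ∷ true  ∷ true  ∷ true  ∷ []) _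
  = bull-at (frame (# 1) ∷ frame (# 0) ∷ splitter ∷ frame (# 4) ∷ seen ∷ [])
G₁-certificate (true  ∷ true  ∷ false ∷ false ∷ false ∷ []) _
  = bull-at (frame (# 2) ∷ frame (# 1) ∷ frame (# 0) ∷ unseen ∷ splitter ∷ [])
G₁-certificate (true  ∷ true  ∷ false ∷ false ∷ true  ∷ []) _
  = bull-at (frame (# 2) ∷ frame (# 1) ∷ frame (# 0) ∷ unseen ∷ splitter ∷ [])
G₁-certificate (true  ∷ true  ∷ false ∷ true  ∷ false ∷ []) _
  = bull-at (frame (# 1) ∷ splitter ∷ frame (# 3) ∷ frame (# 4) ∷ seen ∷ [])
G₁-certificate (true  ∷ true  ∷ false ∷ true  ∷ true  ∷ []) _
  = bull-at (frame (# 0) ∷ splitter ∷ frame (# 3) ∷ frame (# 2) ∷ frame (# 4) ∷ [])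
G₁-certificate (true  ∷ true  ∷ true  ∷ false ∷ false ∷ []) _
  = bull-at (frame (# 4) ∷ frame (# 3) ∷ seen ∷ splitter ∷ unseen ∷ [])
G₁-certificate (true  ∷ true  ∷ true  ∷ false ∷ true  ∷ []) _
  = bull-at (frame (# 4) ∷ splitter ∷ frame (# 0) ∷ unseen ∷ frame (# 1) ∷ [])
G₁-certificate (true  ∷ true  ∷ true  ∷ true  ∷ false ∷ []) _
  = bull-at (frame (# 0) ∷ splitter ∷ frame (# 3) ∷ frame (# 4) ∷ frame (# 2) ∷ [])
G₁-certificate (true  ∷ true  ∷ true  ∷ true  ∷ true  ∷ []) _
  = bull-at (frame (# 1) ∷ splitter ∷ frame (# 3) ∷ unseen ∷ frame (# 4) ∷ [])

-- p₁ p₃ p₄ p₅ d, on which p₂ and a are adjacent twins.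
G₂-frame : Fin 5 → V G₂
G₂-frame = lookup (# 0 ∷ # 2 ∷ # 3 ∷ # 4 ∷ # 5 ∷ [])

G₂-certificate : BullCertificate (λ i j → adj? G₂ (G₂-frame i) (G₂-frame j)) (trace G₂ G₂-frame (# 1))
G₂-certificate (false ∷ false ∷ false ∷ false ∷ false ∷ []) _
  = bull-at (frame (# 2) ∷ frame (# 1) ∷ seen ∷ splitter ∷ unseen ∷ [])
G₂-certificate (false ∷ false ∷ false ∷ false ∷ true  ∷ []) _
  = bull-at (frame (# 2) ∷ frame (# 1) ∷ seen ∷ splitter ∷ unseen ∷ [])
G₂-certificate (false ∷ false ∷ false ∷ true  ∷ false ∷ []) _
  = bull-at (frame (# 2) ∷ frame (# 1) ∷ seen ∷ splitter ∷ unseen ∷ [])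
G₂-certificate (false ∷ false ∷ false ∷ true  ∷ true  ∷ []) _
  = bull-at (frame (# 2) ∷ frame (# 1) ∷ seen ∷ splitter ∷ unseen ∷ [])
G₂-certificate (false ∷ false ∷ true  ∷ false ∷ false ∷ []) _
  = bull-at (frame (# 3) ∷ frame (# 0) ∷ seen ∷ splitter ∷ unseen ∷ [])
G₂-certificate (false ∷ false ∷ true  ∷ false ∷ true  ∷ []) _
  = bull-at (frame (# 3) ∷ frame (# 0) ∷ seen ∷ splitter ∷ unseen ∷ [])
G₂-certificate (false ∷ false ∷ true  ∷ true  ∷ false ∷ []) _
  = bull-at (frame (# 0) ∷ frame (# 3) ∷ frame (# 2) ∷ frame (# 1) ∷ splitter ∷ [])
G₂-certificate (false ∷ false ∷ true  ∷ true  ∷ true  ∷ []) _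
  = bull-at (frame (# 0) ∷ frame (# 3) ∷ frame (# 2) ∷ frame (# 1) ∷ splitter ∷ [])
G₂-certificate (false ∷ true  ∷ false ∷ false ∷ false ∷ []) _
  = bull-at (frame (# 0) ∷ seen ∷ frame (# 1) ∷ frame (# 2) ∷ splitter ∷ [])
G₂-certificate (false ∷ true  ∷ false ∷ false ∷ true  ∷ []) _
  = bull-at (frame (# 0) ∷ seen ∷ frame (# 1) ∷ frame (# 2) ∷ splitter ∷ [])
G₂-certificate (false ∷ true  ∷ false ∷ true  ∷ false ∷ []) _
  = bull-at (frame (# 0) ∷ seen ∷ frame (# 1) ∷ frame (# 2) ∷ splitter ∷ [])
G₂-certificate (false ∷ true  ∷ false ∷ true  ∷ true  ∷ []) _
  = bull-at (frame (# 0) ∷ frame (# 3) ∷ splitter ∷ frame (# 1) ∷ frame (# 4) ∷ [])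
G₂-certificate (false ∷ true  ∷ true  ∷ false ∷ false ∷ []) _
  = bull-at (frame (# 3) ∷ frame (# 0) ∷ seen ∷ splitter ∷ unseen ∷ [])
G₂-certificate (false ∷ true  ∷ true  ∷ false ∷ true  ∷ []) _
  = bull-at (frame (# 0) ∷ seen ∷ splitter ∷ frame (# 4) ∷ frame (# 1) ∷ [])
G₂-certificate (false ∷ true  ∷ true  ∷ true  ∷ false ∷ []) _
  = bull-at (frame (# 4) ∷ frame (# 3) ∷ splitter ∷ seen ∷ frame (# 2) ∷ [])
G₂-certificate (false ∷ true  ∷ true  ∷ true  ∷ true  ∷ []) _
  = bull-at (frame (# 0) ∷ frame (# 3) ∷ splitter ∷ frame (# 1) ∷ frame (# 4) ∷ [])
G₂-certificate (true  ∷ false ∷ false ∷ false ∷ false ∷ []) _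
  = bull-at (frame (# 1) ∷ seen ∷ frame (# 0) ∷ frame (# 3) ∷ splitter ∷ [])
G₂-certificate (true  ∷ false ∷ false ∷ false ∷ true  ∷ []) _
  = bull-at (frame (# 1) ∷ seen ∷ frame (# 0) ∷ frame (# 3) ∷ splitter ∷ [])
G₂-certificate (true  ∷ false ∷ false ∷ true  ∷ false ∷ []) _
  = bull-at (frame (# 2) ∷ frame (# 1) ∷ seen ∷ splitter ∷ unseen ∷ [])
G₂-certificate (true  ∷ false ∷ false ∷ true  ∷ true  ∷ []) _
  = bull-at (frame (# 1) ∷ seen ∷ splitter ∷ frame (# 4) ∷ frame (# 0) ∷ [])
G₂-certificate (true  ∷ false ∷ true  ∷ false ∷ false ∷ []) _
  = bull-at (frame (# 1) ∷ seen ∷ frame (# 0) ∷ frame (# 3) ∷ splitter ∷ [])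
G₂-certificate (true  ∷ false ∷ true  ∷ false ∷ true  ∷ []) _
  = bull-at (frame (# 1) ∷ seen ∷ frame (# 0) ∷ frame (# 3) ∷ splitter ∷ [])
G₂-certificate (true  ∷ false ∷ true  ∷ true  ∷ false ∷ []) _
  = bull-at (frame (# 1) ∷ frame (# 2) ∷ frame (# 3) ∷ frame (# 4) ∷ splitter ∷ [])
G₂-certificate (true  ∷ false ∷ true  ∷ true  ∷ true  ∷ []) _
  = bull-at (frame (# 1) ∷ seen ∷ splitter ∷ frame (# 4) ∷ frame (# 0) ∷ [])
G₂-certificate (true  ∷ true  ∷ false ∷ false ∷ false ∷ []) ≢pat
  = ⊥-elim (≢pat refl)
G₂-certificate (true  ∷ true  ∷ false ∷ false ∷ true  ∷ []) _
  = bull-at (frame (# 2) ∷ frame (# 1) ∷ splitter ∷ frame (# 4) ∷ seen ∷ [])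
G₂-certificate (true  ∷ true  ∷ false ∷ true  ∷ false ∷ []) _
  = bull-at (frame (# 1) ∷ splitter ∷ frame (# 3) ∷ frame (# 4) ∷ frame (# 0) ∷ [])
G₂-certificate (true  ∷ true  ∷ false ∷ true  ∷ true  ∷ []) _
  = bull-at (frame (# 2) ∷ frame (# 1) ∷ splitter ∷ frame (# 4) ∷ seen ∷ [])
G₂-certificate (true  ∷ true  ∷ true  ∷ false ∷ false ∷ []) _
  = bull-at (frame (# 3) ∷ frame (# 2) ∷ frame (# 1) ∷ unseen ∷ splitter ∷ [])
G₂-certificate (true  ∷ true  ∷ true  ∷ false ∷ true  ∷ []) _
  = bull-at (frame (# 3) ∷ frame (# 2) ∷ frame (# 1) ∷ unseen ∷ splitter ∷ [])
G₂-certificate (true  ∷ true  ∷ true  ∷ true  ∷ false ∷ []) _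
  = bull-at (frame (# 1) ∷ splitter ∷ frame (# 3) ∷ frame (# 4) ∷ frame (# 0) ∷ [])
G₂-certificate (true  ∷ true  ∷ true  ∷ true  ∷ true  ∷ []) _
  = bull-at (frame (# 4) ∷ splitter ∷ frame (# 1) ∷ unseen ∷ frame (# 2) ∷ [])

lemma6 : (G : Graph) → Prime G → BullFree G →
    ¬ InducedSub G₁ G × ¬ InducedSub G₂ G
lemma6 G prime bullFree =
  certified-twins⇒¬InducedSub G₁-frame (# 0) (# 6) _ refl (zero , _) G₁-certificate prime bullFree ,
  certified-twins⇒¬InducedSub G₂-frame (# 1) (# 6) _ refl (zero , _) G₂-certificate prime bullFree
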